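{- Let $n$ be a positive integer and let $X \subseteq \mathbb{Z}_{2n}\times\mathbb{Z}_{2n}$ with $|X| = 4n+1$ such that $2n-1$ elements of $X$ lie in a particular row (i.e. have the same first coordinate). Then there exist $2n$ distinct elements of $X$ whose sum is $(0,0)$.
   Context: A row of $\mathbb{Z}_{2n}\times\mathbb{Z}_{2n}$ is a set $\{(a,y): y \in \mathbb{Z}_{2n}\}$ for fixed $a\in\mathbb{Z}_{2n}$. -}

module Defs where

open import Data.Nat using (ℕ; suc; _+_; _*_; _%_; NonZero)
open import Data.Fin using (Fin; toℕ)
open import Data.Product using (_×_; proj₁; proj₂)
open import Data.List using (List; map; filter; length)
open import Data.Nat.ListAction using (sum)
open import Relation.Binary.PropositionalEquality using (_≡_)
open import Relation.Nullary using (Dec)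
open import Data.Fin using (_≟_)

ZZ : ℕ → Set
ZZ m = Fin m × Fin m

rowCount : ∀ {m} → Fin m → List (ZZ m) → ℕ
rowCount a xs = length (filter (λ p → proj₁ p ≟ a) xs)

SumsToZero : (m : ℕ) → .{{_ : NonZero m}} → List (ZZ m) → Set
SumsToZero m xs =
  (sum (map (λ p → toℕ (proj₁ p)) xs) % m ≡ 0) ×
  (sum (map (λ p → toℕ (proj₂ p)) xs) % m ≡ 0)

module Submission where

-- Let m = 2n and let a be the row holding m − 1 points of X: these are the points (a, y₀ + o),
-- 0 < o < m, for a single missing y₀.  Measure first coordinates from row a (δ p ≡ x − a), so the
-- m + 2 points of X off row a have δ ≢ 0.  The k-subsets of {1, …, m − 1} realise every sum in an
-- interval of length k (m − 1 − k) + 1, so an off-row set T with δ-sum 0 can be completed by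
-- m − |T| points of row a to a zero-sum m-set when 3 ≤ |T| ≤ m − 2, when |T| ∈ {2, m − 1} unless
-- its y-sum is one excluded residue, and when |T| = m if its y-sum is 0.  Such a T exists: a
-- pigeonhole argument on the prefix sums of δ yields either a short zero-sum block or two zero-sum
-- candidates that differ in one point of equal δ; a point is determined by (δ, y), so their y-sums
-- differ and one of them avoids the excluded residue.  Evenness of m only serves to exclude m = 5,
-- where two complementary pairs would together have the bad size m − 1.

open import Defs
open import Data.Empty using (⊥; ⊥-elim)
open import Data.Fin using (Fin; zero; suc; toℕ; fromℕ<) renaming (_≟_ to _≟ᶠ_)
open import Data.Fin.Properties using (toℕ-fromℕ<; toℕ-injective; toℕ<n; pigeonhole; ¬∀⟶∃¬)
  renaming (all? to all-Fin?)
open import Data.List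
  using (List; []; _∷_; _++_; length; map; allFin; take; drop; filter; partition; cartesianProduct)
open import Data.List.Membership.Propositional using (_∈_; _∉_; find; lose)
open import Data.List.Membership.Propositional.Properties
  using (∈-∃++; ∈-allFin; ∈-filter⁻; ∈-map⁺; ∈-map⁻; ∈-++⁻; ∈-cartesianProduct⁺)
open import Data.List.Properties
  using (length-tabulate; map-++; length-take; length-map; take-all; take-[]; length-++; partition-defn)
open import Data.List.Relation.Binary.Permutation.Propositional
  using (_↭_; prep; swap; ↭-sym; ↭-trans; ↭⇒↭ₛ; ↭ₛ⇒↭) renaming (refl to ↭-refl)
open import Data.List.Relation.Binary.Permutation.Propositional.Properties
  using (∈-resp-↭; shift; shifts; ↭-length) renaming (map⁺ to ↭-map⁺)
import Data.List.Relation.Binary.Permutation.Setoid.Properties as PermutationSetoid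
open import Data.List.Relation.Binary.Sublist.Propositional
  using ([]; _∷_; _∷ʳ_; lookup; minimum; ⊆-refl; ⊆-trans) renaming (_⊆_ to _⊑_)
open import Data.List.Relation.Binary.Sublist.Propositional.Properties
  using (All-resp-⊆; take-⊆; drop-⊆; length-mono-≤) renaming (map⁺ to ⊑-map⁺)
open import Data.List.Relation.Binary.Subset.Propositional using (_⊆_)
open import Data.List.Relation.Unary.All as All using (All; []; _∷_; all?)
open import Data.List.Relation.Unary.All.Properties using (¬All⇒Any¬) renaming (map⁺ to All-map⁺)
open import Data.List.Relation.Unary.Any using (here; there; any?)
open import Data.List.Relation.Unary.Unique.Propositional using (Unique; []; _∷_)
open import Data.List.Relation.Unary.Unique.Propositional.Properties
  using (filter⁺) renaming (++⁺ to Unique-++⁺)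
open import Data.Nat
  using (ℕ; zero; suc; _+_; _*_; _∸_; _≤_; _<_; z≤n; s≤s; s<s; _≤?_; NonZero; >-nonZero⁻¹)
  renaming (_≟_ to _≟ℕ_)
open import Data.Nat.DivMod using (_%_; %-distribˡ-+; m%n%n≡m%n; m%n<n; m<n⇒m%n≡m; n%n≡0; m*n%n≡0)
open import Data.Nat.ListAction using (sum)
open import Data.Nat.ListAction.Properties using (sum-++; sum-↭)
open import Data.Nat.Properties
open import Algebra.Properties.CommutativeSemigroup +-commutativeSemigroup
  using () renaming (x∙yz≈y∙xz to +-x∙yz≈y∙xz; interchange to +-interchange)
open import Data.Nat.Tactic.RingSolver using (solve-∀)
open import Data.Product using (∃; ∃₂; _×_; _,_; proj₁; proj₂)
open import Data.Product.Properties using (≡-dec)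
open import Data.Sum using (_⊎_; inj₁; inj₂; [_,_]′)
open import Function using (_∘_; id; case_of_)
open import Relation.Binary.Bundles using (Setoid)
open import Relation.Binary.Definitions using (_Respects_; tri<; tri≈; tri>)
open import Relation.Binary.PropositionalEquality
  using (_≡_; _≢_; refl; sym; trans; cong; cong₂; subst; setoid; module ≡-Reasoning)
import Relation.Binary.Reasoning.Setoid
open import Relation.Nullary using (¬_; Dec; yes; no)
open import Relation.Nullary.Decidable using (map′)
open import Relation.Unary using (Decidable)
open import Relation.Unary.Properties using (∁?)

module Congruence (m : ℕ) .{{_ : NonZero m}} where

  infix 4 _≈_ _≉_ _≈?_

  record _≈_ (x y : ℕ) : Set where
    constructor mod-eq
    field %-eq : x % m ≡ y % m

  _≉_ : ℕ → ℕ → Set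
  x ≉ y = ¬ (x ≈ y)

  ≈-reflexive : ∀ {x y} → x ≡ y → x ≈ y
  ≈-reflexive x≡y = mod-eq (cong (_% m) x≡y)

  ≈-refl : ∀ {x} → x ≈ x
  ≈-refl = mod-eq refl

  ≈-sym : ∀ {x y} → x ≈ y → y ≈ x
  ≈-sym (mod-eq e) = mod-eq (sym e)

  ≈-trans : ∀ {x y z} → x ≈ y → y ≈ z → x ≈ z
  ≈-trans (mod-eq e) (mod-eq e′) = mod-eq (trans e e′)

  _≈?_ : (x y : ℕ) → Dec (x ≈ y)
  x ≈? y = map′ mod-eq _≈_.%-eq (x % m ≟ℕ y % m)

  ≈-setoid : Setoid _ _
  ≈-setoid = record
    { _≈_           = _≈_
    ; isEquivalence = record { refl = ≈-refl ; sym = ≈-sym ; trans = ≈-trans }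
    }

  module ≈-Reasoning = Relation.Binary.Reasoning.Setoid ≈-setoid

  %-≈ : ∀ x → x % m ≈ x
  %-≈ x = mod-eq (m%n%n≡m%n x m)

  0%m≡0 : 0 % m ≡ 0
  0%m≡0 = m<n⇒m%n≡m (>-nonZero⁻¹ m)

  ≈0⇒%≡0 : ∀ {x} → x ≈ 0 → x % m ≡ 0
  ≈0⇒%≡0 (mod-eq e) = trans e 0%m≡0

  m≈0 : m ≈ 0
  m≈0 = mod-eq (trans (n%n≡0 m) (sym 0%m≡0))

  *m≈0 : ∀ k → k * m ≈ 0
  *m≈0 k = mod-eq (trans (m*n%n≡0 k m) (sym 0%m≡0))

  m*≈0 : ∀ k → m * k ≈ 0
  m*≈0 k = ≈-trans (≈-reflexive (*-comm m k)) (*m≈0 k)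

  +-cong : ∀ {a b c d} → a ≈ b → c ≈ d → a + c ≈ b + d
  +-cong {a} {b} {c} {d} (mod-eq a≈b) (mod-eq c≈d) = mod-eq (begin
    (a + c) % m          ≡⟨ %-distribˡ-+ a c m ⟩
    (a % m + c % m) % m  ≡⟨ cong₂ (λ x y → (x + y) % m) a≈b c≈d ⟩
    (b % m + d % m) % m  ≡⟨ %-distribˡ-+ b d m ⟨
    (b + d) % m          ∎)
    where open ≡-Reasoning

  +-congˡ : ∀ a {b c} → b ≈ c → a + b ≈ a + c
  +-congˡ a = +-cong (≈-refl {a})

  +-congʳ : ∀ c {a b} → a ≈ b → a + c ≈ b + c
  +-congʳ c a≈b = +-cong a≈b (≈-refl {c})

  negate : ℕ → ℕ
  negate x = (m ∸ x % m) % m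

  negate<m : ∀ x → negate x < m
  negate<m x = m%n<n (m ∸ x % m) m

  +-negate : ∀ x → x + negate x ≈ 0
  +-negate x = begin
    x + negate x          ≈⟨ +-cong (%-≈ x) (≈-sym (%-≈ (m ∸ x % m))) ⟨
    x % m + (m ∸ x % m)   ≡⟨ m+[n∸m]≡n (<⇒≤ (m%n<n x m)) ⟩
    m                     ≈⟨ m≈0 ⟩
    0                     ∎
    where open ≈-Reasoning

  negate-≈0 : ∀ {x} → x ≈ 0 → negate x ≡ 0
  negate-≈0 x≈0 = trans (cong (λ r → (m ∸ r) % m) (≈0⇒%≡0 x≈0)) (n%n≡0 m)

  +-cancelʳ-≈ : ∀ c {a b} → a + c ≈ b + c → a ≈ b
  +-cancelʳ-≈ c {a} {b} a+c≈b+c = begin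
    a                     ≡⟨ +-identityʳ a ⟨
    a + 0                 ≈⟨ +-congˡ a (+-negate c) ⟨
    a + (c + negate c)    ≡⟨ +-assoc a c _ ⟨
    a + c + negate c      ≈⟨ +-congʳ (negate c) a+c≈b+c ⟩
    b + c + negate c      ≡⟨ +-assoc b c _ ⟩
    b + (c + negate c)    ≈⟨ +-congˡ b (+-negate c) ⟩
    b + 0                 ≡⟨ +-identityʳ b ⟩
    b                     ∎
    where open ≈-Reasoning

  +-cancelˡ-≈ : ∀ c {a b} → c + a ≈ c + b → a ≈ b
  +-cancelˡ-≈ c {a} {b} c+a≈c+b =
    +-cancelʳ-≈ c (≈-trans (≈-reflexive (+-comm a c)) (≈-trans c+a≈c+b (≈-reflexive (+-comm c b))))

  negate-injective : ∀ {x y} → negate x ≡ negate y → x ≈ y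
  negate-injective {x} {y} eq = +-cancelʳ-≈ (negate x)
    (≈-trans (+-negate x) (≈-sym (subst (λ z → y + z ≈ 0) (sym eq) (+-negate y))))

  ≈⇒≡ : ∀ {x y} → x < m → y < m → x ≈ y → x ≡ y
  ≈⇒≡ x<m y<m (mod-eq e) = trans (sym (m<n⇒m%n≡m x<m)) (trans e (m<n⇒m%n≡m y<m))

  toℕ-≈-injective : ∀ {i j : Fin m} → toℕ i ≈ toℕ j → i ≡ j
  toℕ-≈-injective {i} {j} eq = toℕ-injective (≈⇒≡ (toℕ<n i) (toℕ<n j) eq)

  residue : ℕ → Fin m
  residue x = fromℕ< (m%n<n x m)

  toℕ-residue : ∀ x → toℕ (residue x) ≈ x
  toℕ-residue x = ≈-trans (≈-reflexive (toℕ-fromℕ< (m%n<n x m))) (%-≈ x)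

  residue-injective : ∀ {x y} → residue x ≡ residue y → x ≈ y
  residue-injective {x} {y} eq =
    ≈-trans (≈-sym (toℕ-residue x)) (≈-trans (≈-reflexive (cong toℕ eq)) (toℕ-residue y))

module _ {A : Set} where

  Unique-resp-↭ : Unique {A = A} Respects _↭_
  Unique-resp-↭ = PermutationSetoid.Unique-resp-↭ (setoid A) ∘ ↭⇒↭ₛ

  Unique-resp-⊒ : ∀ {xs ys : List A} → xs ⊑ ys → Unique ys → Unique xs
  Unique-resp-⊒ []             u            = u
  Unique-resp-⊒ (y ∷ʳ xs⊑ys)   (_ ∷ u)      = Unique-resp-⊒ xs⊑ys u
  Unique-resp-⊒ (refl ∷ xs⊑ys) (y∉ys ∷ u)   = All-resp-⊆ xs⊑ys y∉ys ∷ Unique-resp-⊒ xs⊑ys u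

  ⊑⇒⊆ : ∀ {xs ys : List A} → xs ⊑ ys → xs ⊆ ys
  ⊑⇒⊆ xs⊑ys = lookup xs⊑ys

  ∈⇒↭∷ : ∀ {x : A} {xs} → x ∈ xs → ∃ λ ys → xs ↭ x ∷ ys
  ∈⇒↭∷ x∈xs with us , vs , refl ← ∈-∃++ x∈xs = us ++ vs , shift _ us vs

  Unique-⊆⇒length≤ : ∀ {xs ys : List A} → Unique xs → xs ⊆ ys → length xs ≤ length ys
  Unique-⊆⇒length≤ [] _ = z≤n
  Unique-⊆⇒length≤ {x ∷ xs} {ys} (x∉xs ∷ u) x∷xs⊆ys
    with ys′ , ys↭ ← ∈⇒↭∷ (x∷xs⊆ys (here refl)) = begin
      suc (length xs)  ≤⟨ s≤s (Unique-⊆⇒length≤ u xs⊆ys′) ⟩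
      suc (length ys′) ≡⟨ ↭-length ys↭ ⟨
      length ys        ∎
    where
    open ≤-Reasoning
    xs⊆ys′ : xs ⊆ ys′
    xs⊆ys′ z∈xs with ∈-resp-↭ ys↭ (x∷xs⊆ys (there z∈xs))
    ... | here refl   = ⊥-elim (All.lookup x∉xs z∈xs refl)
    ... | there z∈ys′ = z∈ys′

  length-partition-filter : ∀ {P : A → Set} (P? : Decidable P) xs →
                            length xs ≡ length (filter P? xs) + length (filter (∁? P?) xs)
  length-partition-filter P? xs = begin
    length xs
      ≡⟨ ↭-length (↭ₛ⇒↭ (PermutationSetoid.partition-↭ (setoid A) P? xs)) ⟩
    length (proj₁ (partition P? xs) ++ proj₂ (partition P? xs))
      ≡⟨ cong (λ (ys , zs) → length (ys ++ zs)) (partition-defn P? xs) ⟩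
    length (filter P? xs ++ filter (∁? P?) xs)
      ≡⟨ length-++ (filter P? xs) ⟩
    length (filter P? xs) + length (filter (∁? P?) xs)
      ∎
    where open ≡-Reasoning

  take-+ : ∀ i d (xs : List A) → take (i + d) xs ≡ take i xs ++ take d (drop i xs)
  take-+ zero    d xs       = refl
  take-+ (suc i) d []       = sym (take-[] d)
  take-+ (suc i) d (x ∷ xs) = cong (x ∷_) (take-+ i d xs)

  length-take-≤ : ∀ n (xs : List A) → n ≤ length xs → length (take n xs) ≡ n
  length-take-≤ n xs n≤ = trans (length-take n xs) (m≤n⇒m⊓n≡m n≤)

  length-take-drop : ∀ i d (xs : List A) → i + d ≤ length xs → length (take d (drop i xs)) ≡ d
  length-take-drop zero    d xs       i+d≤ = length-take-≤ d xs i+d≤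
  length-take-drop (suc i) d (x ∷ xs) i+d≤ = length-take-drop i d xs (≤-pred i+d≤)

  sumBy : (A → ℕ) → List A → ℕ
  sumBy f xs = sum (map f xs)

  sumBy-++ : ∀ f (xs ys : List A) → sumBy f (xs ++ ys) ≡ sumBy f xs + sumBy f ys
  sumBy-++ f xs ys = trans (cong sum (map-++ f xs ys)) (sum-++ (map f xs) (map f ys))

  sumBy-↭ : ∀ f {xs ys : List A} → xs ↭ ys → sumBy f xs ≡ sumBy f ys
  sumBy-↭ f xs↭ys = sum-↭ (↭-map⁺ f xs↭ys)

  sumBy-const : ∀ (f : A → ℕ) {c xs} → All (λ x → f x ≡ c) xs → sumBy f xs ≡ length xs * c
  sumBy-const f []            = refl
  sumBy-const f (fx≡c ∷ fxs) = cong₂ _+_ fx≡c (sumBy-const f fxs)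

  sumBy-+-const : ∀ (f : A → ℕ) c xs → sumBy (λ x → f x + c) xs ≡ sumBy f xs + length xs * c
  sumBy-+-const f c []       = refl
  sumBy-+-const f c (x ∷ xs) =
    trans (cong (f x + c +_) (sumBy-+-const f c xs)) (+-interchange (f x) c _ _)

Unique⇒length≤ : ∀ {n} {xs : List (Fin n)} → Unique xs → length xs ≤ n
Unique⇒length≤ u = ≤-trans (Unique-⊆⇒length≤ u (λ _ → ∈-allFin _)) (≤-reflexive (length-tabulate id))

range : ℕ → ℕ → List ℕ
range s zero    = []
range s (suc l) = s ∷ range (suc s) l

∈-range⁻ : ∀ {o} s l → o ∈ range s l → s ≤ o × o < s + l
∈-range⁻ s (suc l) (here refl) = ≤-refl , ≤-trans (s≤s (m≤m+n s l)) (≤-reflexive (sym (+-suc s l)))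
∈-range⁻ s (suc l) (there o∈) with s<o , o< ← ∈-range⁻ (suc s) l o∈ =
  <⇒≤ s<o , ≤-trans o< (≤-reflexive (sym (+-suc s l)))

sum-range-suc : ∀ s l → sum (range (suc s) l) ≡ l + sum (range s l)
sum-range-suc s zero    = refl
sum-range-suc s (suc l) = begin
  suc s + sum (range (2 + s) l)        ≡⟨ cong (suc s +_) (sum-range-suc (suc s) l) ⟩
  suc s + (l + sum (range (suc s) l))  ≡⟨ cong suc (+-x∙yz≈y∙xz s l _) ⟩
  suc l + (s + sum (range (suc s) l))  ∎
  where open ≡-Reasoning

subset-sums : ∀ s k e q → q ≤ k * e →
              ∃ λ os → os ⊑ range s (k + e) × length os ≡ k × sum os ≡ sum (range s k) + q
subset-sums s zero e q q≤0 = [] , minimum _ , refl , cong (0 +_) (sym (n≤0⇒n≡0 q≤0))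
subset-sums s (suc k) e q q≤ with q ≤? k * e
... | yes q≤ke with os , os⊑ , |os| , Σos ← subset-sums (suc s) k e q q≤ke =
  s ∷ os , refl ∷ os⊑ , cong suc |os| , trans (cong (s +_) Σos) (sym (+-assoc s _ q))
... | no q≰ke with e
...   | zero = ⊥-elim (q≰ke (≤-trans q≤ (≤-trans (≤-reflexive (*-zeroʳ (suc k))) z≤n)))
...   | suc e′ with os , os⊑ , |os| , Σos ← subset-sums (suc s) (suc k) e′ (q ∸ suc k)
                   (m≤n+o⇒m∸n≤o q (suc k) (≤-trans q≤ (≤-reflexive (*-suc (suc k) e′)))) =
  os , subst (λ l → os ⊑ range s l) (sym (+-suc (suc k) e′)) (s ∷ʳ os⊑) , |os| , (begin
    sum os                                  ≡⟨ Σos ⟩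
    sum (range (suc s) (suc k)) + (q ∸ suc k) ≡⟨ cong (_+ (q ∸ suc k)) (sum-range-suc s (suc k)) ⟩
    suc k + σ + (q ∸ suc k)                 ≡⟨ cong (_+ (q ∸ suc k)) (+-comm (suc k) σ) ⟩
    σ + suc k + (q ∸ suc k)                 ≡⟨ +-assoc σ (suc k) _ ⟩
    σ + (suc k + (q ∸ suc k))               ≡⟨ cong (σ +_) (m+[n∸m]≡n 1+k≤q) ⟩
    σ + q                                   ∎)
  where
  open ≡-Reasoning
  σ = sum (range s (suc k))
  1+k≤q : suc k ≤ q
  1+k≤q = ≤-trans (s≤s (m≤m*n k (suc e′))) (≰⇒> q≰ke)

k+e≤k*e : ∀ {k e} → 2 ≤ k → 2 ≤ e → k + e ≤ k * e
k+e≤k*e {suc (suc c)} {suc (suc d)} (s≤s (s≤s z≤n)) (s≤s (s≤s z≤n)) =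
  ≤-trans (m≤m+n _ (c + d + c * d)) (≤-reflexive (product c d))
  where
  product : ∀ c d → (2 + c) + (2 + d) + (c + d + c * d) ≡ (2 + c) * (2 + d)
  product = solve-∀

module _ (w : ℕ) where

  open Congruence (4 + w)

  Dichotomous : (ℕ → ℕ → Set) → ℕ → Set
  Dichotomous Admissible j = ∀ {t t′} → t ≉ t′ → Admissible j t ⊎ Admissible j t′

  -- Admissible j t: an off-row set of j points with δ-sum 0 and y-sum t can be completed by points
  -- of the special row to a zero-sum set of m = 4 + w points.  The selection argument below uses
  -- nothing else about completability.
  record Admissibility : Set₁ where
    field
      Admissible          : ℕ → ℕ → Set
      middle              : ∀ {j t} → 3 ≤ j → j ≤ 2 + w → Admissible j t
      pair-dichotomy      : Dichotomous Admissible 2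
      near-full-dichotomy : Dichotomous Admissible (3 + w)
      two-pairs           : ∀ t t′ → Admissible 2 t ⊎ Admissible 2 t′ ⊎ Admissible 4 (t + t′)

module Selection (w : ℕ) {P : Set} (δ y : P → ℕ)
  (point-injective : ∀ {p q} → Congruence._≈_ (4 + w) (δ p) (δ q) →
                               Congruence._≈_ (4 + w) (y p) (y q) → p ≡ q)
  (admissibility : Admissibility w) where

  open Congruence (4 + w)
  open Admissibility admissibility

  Σδ Σy : List P → ℕ
  Σδ = sumBy δ
  Σy = sumBy y

  NoZero NoZeroPair : List P → Set
  NoZero L     = ∀ {p} → p ∈ L → δ p ≉ 0
  NoZeroPair L = ∀ {p q} → p ∈ L → q ∈ L → p ≢ q → δ p + δ q ≉ 0

  NoZeroPair-mono : ∀ {L L′} → L′ ⊆ L → NoZeroPair L → NoZeroPair L′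
  NoZeroPair-mono L′⊆L np p∈ q∈ = np (L′⊆L p∈) (L′⊆L q∈)

  -- The off-row part of the final zero-sum set, chosen inside L.
  record Solution (L : List P) : Set where
    constructor solution
    field
      T          : List P
      T⊆L        : T ⊆ L
      T-unique   : Unique T
      zero-sum   : Σδ T ≈ 0
      admissible : Admissible (length T) (Σy T)

  Solution-mono : ∀ {L L′} → L ⊆ L′ → Solution L → Solution L′
  Solution-mono L⊆L′ (solution T T⊆L u z a) = solution T (L⊆L′ ∘ T⊆L) u z a

  sublist-solution : ∀ {T L} → T ⊑ L → Unique L → Σδ T ≈ 0 → Admissible (length T) (Σy T) →
                     Solution L
  sublist-solution T⊑L u = solution _ (⊑⇒⊆ T⊑L) (Unique-resp-⊒ T⊑L u)

  Σδ-swap : ∀ p q L → Σδ (p ∷ q ∷ L) ≡ Σδ (q ∷ p ∷ L)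
  Σδ-swap p q L = sumBy-↭ δ (swap p q (↭-refl {xs = L}))

  Σδ-pair : ∀ p q → Σδ (p ∷ q ∷ []) ≡ δ p + δ q
  Σδ-pair p q = cong (δ p +_) (+-identityʳ (δ q))

  Σδ-row : ∀ {u L} → All (λ p → δ p ≈ u) L → Σδ L ≈ length L * u
  Σδ-row []            = ≈-refl
  Σδ-row (δp≈u ∷ row) = +-cong δp≈u (Σδ-row row)

  row-length≤ : ∀ {u L} → Unique L → All (λ p → δ p ≈ u) L → length L ≤ 4 + w
  row-length≤ {u} {L} uL row =
    subst (_≤ 4 + w) (length-map _ L) (Unique⇒length≤ (residues-unique uL row))
    where
    residues-distinct : ∀ {p L} → δ p ≈ u → All (p ≢_) L → All (λ q → δ q ≈ u) L →
                        All (residue (y p) ≢_) (map (residue ∘ y) L)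
    residues-distinct δp≈u []          []           = []
    residues-distinct δp≈u (p≢q ∷ p∉L) (δq≈u ∷ row) =
      (p≢q ∘ point-injective (≈-trans δp≈u (≈-sym δq≈u)) ∘ residue-injective)
      ∷ residues-distinct δp≈u p∉L row
    residues-unique : ∀ {L} → Unique L → All (λ p → δ p ≈ u) L → Unique (map (residue ∘ y) L)
    residues-unique []         []           = []
    residues-unique (p∉L ∷ uL) (δp≈u ∷ row) = residues-distinct δp≈u p∉L row ∷ residues-unique uL row

  short-zero-sum : ∀ {T L} → NoZero L → NoZeroPair L → T ⊑ L → Unique L →
                   Σδ T ≈ 0 → 1 ≤ length T → length T ≤ 2 + w → Solution L
  short-zero-sum {p ∷ []} nz _ T⊑L _ T≈0 _ _ =
    ⊥-elim (nz (⊑⇒⊆ T⊑L (here refl)) (≈-trans (≈-reflexive (sym (+-identityʳ (δ p)))) T≈0))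
  short-zero-sum {p ∷ q ∷ []} _ np T⊑L uL T≈0 _ _ with (p≢q ∷ []) ∷ _ ← Unique-resp-⊒ T⊑L uL =
    ⊥-elim (np (⊑⇒⊆ T⊑L (here refl)) (⊑⇒⊆ T⊑L (there (here refl))) p≢q
               (≈-trans (≈-reflexive (sym (Σδ-pair p q))) T≈0))
  short-zero-sum {_ ∷ _ ∷ _ ∷ _} _ _ T⊑L uL T≈0 _ |T|≤ =
    sublist-solution T⊑L uL T≈0 (middle (s≤s (s≤s (s≤s z≤n))) |T|≤)

  exchange : ∀ {j a a′ S L} → Dichotomous w Admissible j → suc (length S) ≡ j →
             Unique (a ∷ a′ ∷ L) → S ⊑ L → δ a ≈ δ a′ → Σδ (a ∷ S) ≈ 0 → Solution (a ∷ a′ ∷ L)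
  exchange {a = a} {a′} {S} dichotomy refl u@((a≢a′ ∷ _) ∷ _) S⊑L δa≈δa′ a∷S≈0 =
    [ sublist-solution (refl ∷ a′ ∷ʳ S⊑L) u a∷S≈0
    , sublist-solution (a ∷ʳ refl ∷ S⊑L) u a′∷S≈0
    ]′ (dichotomy y-sums-differ)
    where
    y-sums-differ : Σy (a ∷ S) ≉ Σy (a′ ∷ S)
    y-sums-differ = a≢a′ ∘ point-injective δa≈δa′ ∘ +-cancelʳ-≈ (Σy S)
    a′∷S≈0 : Σδ (a′ ∷ S) ≈ 0
    a′∷S≈0 = ≈-trans (+-congʳ (Σδ S) (≈-sym δa≈δa′)) a∷S≈0

  zero-block : ∀ i d xs → length xs ≡ 3 + w → i + d ≤ 3 + w → 1 ≤ d → Σδ (take d (drop i xs)) ≈ 0 →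
               (∃ λ bs → bs ⊑ xs × 1 ≤ length bs × length bs ≤ 2 + w × Σδ bs ≈ 0) ⊎ Σδ xs ≈ 0
  zero-block i d xs |xs| i+d≤ 1≤d bs≈0 with d ≤? 2 + w
  ... | yes d≤ = inj₁ (_ , ⊆-trans (take-⊆ d _) (drop-⊆ i xs) ,
                       subst (1 ≤_) (sym |bs|) 1≤d , subst (_≤ 2 + w) (sym |bs|) d≤ , bs≈0)
    where
    |bs| : length (take d (drop i xs)) ≡ d
    |bs| = length-take-drop i d xs (subst (i + d ≤_) (sym |xs|) i+d≤)
  ... | no d≰ with i
  ...   | zero   =
    inj₂ (subst (λ bs → Σδ bs ≈ 0) (take-all d xs (≤-trans (≤-reflexive |xs|) (≰⇒> d≰))) bs≈0)
  ...   | suc i′ = ⊥-elim (d≰ (≤-trans (m≤n+m d i′) (≤-pred i+d≤)))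

  prefix-residue : ℕ → List P → Fin (5 + w) → Fin (4 + w)
  prefix-residue v xs zero    = residue v
  prefix-residue v xs (suc j) = residue (Σδ (take (toℕ j) xs))

  prefix-or-block : ∀ v xs → length xs ≡ 3 + w →
      (∃ λ j → j ≤ 3 + w × v ≈ Σδ (take j xs))
    ⊎ (∃ λ bs → bs ⊑ xs × 1 ≤ length bs × length bs ≤ 2 + w × Σδ bs ≈ 0)
    ⊎ Σδ xs ≈ 0
  prefix-or-block v xs |xs| with pigeonhole ≤-refl (prefix-residue v xs)
  ... | zero  , zero  , ()      , _
  ... | suc _ , zero  , ()      , _
  ... | zero  , suc j , _       , eq = inj₁ (toℕ j , ≤-pred (toℕ<n j) , residue-injective eq)
  ... | suc i , suc j , s<s i<j , eq = inj₂ (zero-block (toℕ i) d xs |xs| i+d≤ (m<n⇒0<n∸m i<j) block≈0)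
    where
    d = toℕ j ∸ toℕ i
    i+d≡j : toℕ i + d ≡ toℕ j
    i+d≡j = m+[n∸m]≡n (<⇒≤ i<j)
    i+d≤ : toℕ i + d ≤ 3 + w
    i+d≤ = subst (_≤ 3 + w) (sym i+d≡j) (≤-pred (toℕ<n j))
    prefix = Σδ (take (toℕ i) xs)
    block  = take d (drop (toℕ i) xs)
    block≈0 : Σδ block ≈ 0
    block≈0 = +-cancelˡ-≈ prefix (begin
      prefix + Σδ block                 ≡⟨ sumBy-++ δ (take (toℕ i) xs) block ⟨
      Σδ (take (toℕ i) xs ++ block)     ≡⟨ cong Σδ (take-+ (toℕ i) d xs) ⟨
      Σδ (take (toℕ i + d) xs)          ≡⟨ cong (λ k → Σδ (take k xs)) i+d≡j ⟩
      Σδ (take (toℕ j) xs)              ≈⟨ residue-injective eq ⟨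
      prefix                            ≡⟨ +-identityʳ prefix ⟨
      prefix + 0                        ∎)
      where open ≈-Reasoning

  -- A prefix p ∷ q ∷ ys whose δ-sum is δ q gives the zero-sum set p ∷ ys, which skips q.
  solution-or-zero-sum : ∀ {L} p q rest → p ∷ q ∷ rest ⊑ L → length rest ≡ 1 + w →
                         Unique L → NoZero L → NoZeroPair L → δ p ≉ δ q →
                         Solution L ⊎ Σδ (p ∷ q ∷ rest) ≈ 0
  solution-or-zero-sum p q rest pqrest⊑L |rest| uL nz np δp≉δq
    with prefix-or-block (δ q) (p ∷ q ∷ rest) (cong (2 +_) |rest|)
  ... | inj₁ (0 , _ , δq≈0)  = ⊥-elim (nz (⊑⇒⊆ pqrest⊑L (there (here refl))) δq≈0)
  ... | inj₁ (1 , _ , δq≈δp) = ⊥-elim (δp≉δq (≈-sym (≈-trans δq≈δp (≈-reflexive (+-identityʳ (δ p))))))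
  ... | inj₁ (suc (suc i) , _ , δq≈) =
    inj₁ (short-zero-sum nz np (⊆-trans (refl ∷ q ∷ʳ take-⊆ i rest) pqrest⊑L) uL p∷S≈0 (s≤s z≤n)
            (s≤s (≤-trans (length-mono-≤ (take-⊆ i rest)) (≤-reflexive |rest|))))
    where
    S = Σδ (take i rest)
    p∷S≈0 : δ p + S ≈ 0
    p∷S≈0 = ≈-sym (+-cancelˡ-≈ (δ q) (begin
      δ q + 0            ≡⟨ +-identityʳ (δ q) ⟩
      δ q                ≈⟨ δq≈ ⟩
      δ p + (δ q + S)    ≡⟨ Σδ-swap p q (take i rest) ⟩
      δ q + (δ p + S)    ∎))
      where open ≈-Reasoning
  ... | inj₂ (inj₁ (bs , bs⊑ , 1≤|bs| , |bs|≤ , bs≈0)) =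
    inj₁ (short-zero-sum nz np (⊆-trans bs⊑ pqrest⊑L) uL bs≈0 1≤|bs| |bs|≤)
  ... | inj₂ (inj₂ pqrest≈0) = inj₂ pqrest≈0

  two-rows⇒solution : ∀ e f z Es → let L = e ∷ f ∷ z ∷ Es in
    length Es ≡ 1 + w → Unique L → NoZero L → NoZeroPair L → δ e ≉ δ z → Solution L
  two-rows⇒solution e f z Es |Es| uL nz np δe≉δz
    with solution-or-zero-sum e z Es (refl ∷ f ∷ʳ ⊆-refl) |Es| uL nz np δe≉δz
  ... | inj₁ sol = sol
  ... | inj₂ ezEs≈0 with δ e ≈? δ f
  ...   | yes δe≈δf = exchange near-full-dichotomy (cong (2 +_) |Es|) uL ⊆-refl δe≈δf ezEs≈0
  ...   | no δe≉δf with solution-or-zero-sum e f Es (refl ∷ refl ∷ z ∷ʳ ⊆-refl) |Es| uL nz np δe≉δf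
  ...     | inj₁ sol = sol
  ...     | inj₂ efEs≈0 = Solution-mono (∈-resp-↭ (↭-sym σ))
              (exchange near-full-dichotomy (cong (2 +_) |Es|) (Unique-resp-↭ σ uL) ⊆-refl δz≈δf zeEs≈0)
    where
    σ : e ∷ f ∷ z ∷ Es ↭ z ∷ f ∷ e ∷ Es
    σ = ↭-trans (swap e f ↭-refl) (↭-trans (prep f (swap e z ↭-refl)) (swap f z ↭-refl))
    δz≈δf : δ z ≈ δ f
    δz≈δf = +-cancelʳ-≈ (Σδ Es) (+-cancelˡ-≈ (δ e) (≈-trans ezEs≈0 (≈-sym efEs≈0)))
    zeEs≈0 : Σδ (z ∷ e ∷ Es) ≈ 0
    zeEs≈0 = ≈-trans (≈-reflexive (Σδ-swap z e Es)) ezEs≈0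

  same-row-or-split : ∀ e L → All (λ q → δ q ≈ δ e) L ⊎ ∃₂ λ z L′ → L ↭ z ∷ L′ × δ e ≉ δ z
  same-row-or-split e L with all? (λ q → δ q ≈? δ e) L
  ... | yes row = inj₁ row
  ... | no ¬row with z , z∈L , δz≉δe ← find (¬All⇒Any¬ (λ q → δ q ≈? δ e) L ¬row)
                with L′ , L↭ ← ∈⇒↭∷ z∈L = inj₂ (z , L′ , L↭ , δz≉δe ∘ ≈-sym)

  solution-or-row : ∀ e L → 3 + w ≤ length L →
                    Unique (e ∷ L) → NoZero (e ∷ L) → NoZeroPair (e ∷ L) →
                    Solution (e ∷ L) ⊎ All (λ q → δ q ≈ δ e) L
  solution-or-row e L 3+w≤|L| uL nz np with same-row-or-split e L
  ... | inj₁ row = inj₂ row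
  ... | inj₂ (z , [] , L↭ , _) =
    ⊥-elim (<⇒≱ (s≤s (s≤s z≤n)) (≤-trans 3+w≤|L| (≤-reflexive (↭-length L↭))))
  ... | inj₂ (z , f ∷ L″ , L↭ , δe≉δz) =
    inj₁ (Solution-mono A⊆e∷L (two-rows⇒solution e f z Es |Es| (Unique-resp-⊒ A⊑ (Unique-resp-↭ σ uL))
                                 (nz ∘ A⊆e∷L) (NoZeroPair-mono A⊆e∷L np) δe≉δz))
    where
    σ : e ∷ L ↭ e ∷ f ∷ z ∷ L″
    σ = ↭-trans (prep e L↭) (prep e (swap z f ↭-refl))
    Es = take (1 + w) L″
    |Es| : length Es ≡ 1 + w
    |Es| = length-take-≤ (1 + w) L″ (≤-pred (≤-pred (≤-trans 3+w≤|L| (≤-reflexive (↭-length L↭)))))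
    A⊑ : e ∷ f ∷ z ∷ Es ⊑ e ∷ f ∷ z ∷ L″
    A⊑ = refl ∷ refl ∷ refl ∷ take-⊆ (1 + w) L″
    A⊆e∷L : e ∷ f ∷ z ∷ Es ⊆ e ∷ L
    A⊆e∷L = ∈-resp-↭ (↭-sym σ) ∘ ⊑⇒⊆ A⊑

  pair-prefix≈0 : ∀ {p q e} L → δ p + δ q ≈ 0 → δ q ≈ Σδ (e ∷ L) → Σδ (e ∷ p ∷ L) ≈ 0
  pair-prefix≈0 {p} {q} {e} L pq≈0 δq≈ = begin
    Σδ (e ∷ p ∷ L)    ≡⟨ Σδ-swap e p L ⟩
    δ p + Σδ (e ∷ L)  ≈⟨ +-congˡ (δ p) δq≈ ⟨
    δ p + δ q         ≈⟨ pq≈0 ⟩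
    0                 ∎
    where open ≈-Reasoning

  -- As δ is constant on e ∷ e′ ∷ Q₁, the sets e ∷ p ∷ take i Q₁ (zero-sum by pair-prefix≈0) of
  -- sizes 2 and 3 + w have the twins e′ ∷ p ∷ take i Q₁; for i = 2 + w, q pairs off with e and e′.
  row-prefix⇒solution : ∀ e e′ p q Q₁ i → let A = e ∷ e′ ∷ p ∷ q ∷ Q₁ in
    length Q₁ ≡ 2 + w → All (λ r → δ r ≈ δ e) (e′ ∷ Q₁) → Unique A → δ p + δ q ≈ 0 →
    i ≤ 2 + w → δ q ≈ Σδ (e ∷ take i Q₁) → Solution A
  row-prefix⇒solution e e′ p q Q₁ zero _ (δe′≈δe ∷ _) uA pq≈0 _ δq≈ =
    exchange pair-dichotomy refl uA (refl ∷ minimum _) (≈-sym δe′≈δe) (pair-prefix≈0 [] pq≈0 δq≈)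
  row-prefix⇒solution e e′ p q Q₁ (suc i) |Q₁| (δe′≈δe ∷ row) uA pq≈0 1+i≤ δq≈ with <-cmp i w
  ... | tri< i<w _ _ =
    sublist-solution (refl ∷ e′ ∷ʳ refl ∷ q ∷ʳ take-⊆ (suc i) Q₁) uA
      (pair-prefix≈0 (take (suc i) Q₁) pq≈0 δq≈)
      (subst (λ k → Admissible (2 + k) (Σy (e ∷ p ∷ take (suc i) Q₁))) (sym |take|)
        (middle (s≤s (s≤s (s≤s z≤n))) (s≤s (s≤s i<w))))
    where
    |take| : length (take (suc i) Q₁) ≡ suc i
    |take| = length-take-≤ (suc i) Q₁ (≤-trans 1+i≤ (≤-reflexive (sym |Q₁|)))
  ... | tri≈ _ refl _ =
    exchange near-full-dichotomy (cong (2 +_) |take|) uA (refl ∷ q ∷ʳ take-⊆ (suc w) Q₁)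
      (≈-sym δe′≈δe) (pair-prefix≈0 (take (suc w) Q₁) pq≈0 δq≈)
    where
    |take| : length (take (suc w) Q₁) ≡ suc w
    |take| = length-take-≤ (suc w) Q₁ (≤-trans (n≤1+n _) (≤-reflexive (sym |Q₁|)))
  ... | tri> _ _ w<i with refl ← ≤-antisym (≤-pred 1+i≤) w<i =
    exchange pair-dichotomy refl uA (p ∷ʳ refl ∷ minimum Q₁) (≈-sym δe′≈δe) eq≈0
    where
    eq≈0 : Σδ (e ∷ q ∷ []) ≈ 0
    eq≈0 = begin
      Σδ (e ∷ q ∷ [])                 ≡⟨ Σδ-pair e q ⟩
      δ e + δ q                       ≈⟨ +-congˡ (δ e) δq≈ ⟩
      δ e + Σδ (e ∷ take (2 + w) Q₁)  ≡⟨ cong (λ L → δ e + Σδ (e ∷ L)) (take-all _ Q₁ (≤-reflexive |Q₁|)) ⟩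
      δ e + (δ e + Σδ Q₁)             ≈⟨ +-congˡ (δ e) (+-congˡ (δ e) (Σδ-row row)) ⟩
      δ e + (δ e + length Q₁ * δ e)   ≡⟨ cong (λ k → δ e + (δ e + k * δ e)) |Q₁| ⟩
      (4 + w) * δ e                   ≈⟨ m*≈0 (δ e) ⟩
      0                               ∎
      where open ≈-Reasoning

  row-and-pair⇒solution : ∀ e e′ p q Q₁ → let A = e ∷ e′ ∷ p ∷ q ∷ Q₁ in
    length Q₁ ≡ 2 + w → All (λ r → δ r ≈ δ e) (e′ ∷ Q₁) →
    Unique A → NoZero A → NoZeroPair (e ∷ Q₁) → δ p + δ q ≈ 0 → Solution A
  row-and-pair⇒solution e e′ p q Q₁ |Q₁| row uA nz np pq≈0
    with prefix-or-block (δ q) (e ∷ Q₁) (cong suc |Q₁|)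
  ... | inj₁ (zero , _ , δq≈0) = ⊥-elim (nz (there (there (there (here refl)))) δq≈0)
  ... | inj₁ (suc i , 1+i≤ , δq≈) =
    row-prefix⇒solution e e′ p q Q₁ i |Q₁| row uA pq≈0 (≤-pred 1+i≤) δq≈
  ... | inj₂ (inj₁ (bs , bs⊑ , 1≤|bs| , |bs|≤ , bs≈0)) =
    Solution-mono (⊑⇒⊆ e∷Q₁⊑A)
      (short-zero-sum (nz ∘ ⊑⇒⊆ e∷Q₁⊑A) np bs⊑ (Unique-resp-⊒ e∷Q₁⊑A uA) bs≈0 1≤|bs| |bs|≤)
    where
    e∷Q₁⊑A : e ∷ Q₁ ⊑ e ∷ e′ ∷ p ∷ q ∷ Q₁
    e∷Q₁⊑A = refl ∷ e′ ∷ʳ p ∷ʳ q ∷ʳ ⊆-refl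
  ... | inj₂ (inj₂ e∷Q₁≈0) with _ ∷ row′ ← row = ⊥-elim (nz (here refl) δe≈0)
    where
    δe≈0 : δ e ≈ 0
    δe≈0 = begin
      δ e                           ≡⟨ +-identityʳ (δ e) ⟨
      δ e + 0                       ≈⟨ +-congˡ (δ e) e∷Q₁≈0 ⟨
      δ e + Σδ (e ∷ Q₁)             ≈⟨ +-congˡ (δ e) (Σδ-row (≈-refl ∷ row′)) ⟩
      δ e + length (e ∷ Q₁) * δ e   ≡⟨ cong (λ k → δ e + suc k * δ e) |Q₁| ⟩
      (4 + w) * δ e                 ≈⟨ m*≈0 (δ e) ⟩
      0                             ∎
      where open ≈-Reasoning

  pair-or-noZeroPair : ∀ L → (∃₂ λ p q → ∃ λ L′ → L ↭ p ∷ q ∷ L′ × δ p + δ q ≈ 0) ⊎ NoZeroPair L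
  pair-or-noZeroPair [] = inj₂ λ ()
  pair-or-noZeroPair (x ∷ L) with any? (λ q → δ x + δ q ≈? 0) L
  ... | yes has with q , q∈L , xq≈0 ← find has with L′ , L↭ ← ∈⇒↭∷ q∈L =
    inj₁ (x , q , L′ , prep x L↭ , xq≈0)
  ... | no none with pair-or-noZeroPair L
  ...   | inj₁ (p , q , L′ , L↭ , pq≈0) =
    inj₁ (p , q , x ∷ L′ , ↭-trans (prep x L↭) (↭-sym (shift x (p ∷ q ∷ []) L′)) , pq≈0)
  ...   | inj₂ np = inj₂ np′
    where
    np′ : NoZeroPair (x ∷ L)
    np′ (here refl) (here refl) x≢x   = ⊥-elim (x≢x refl)
    np′ (here refl) (there q∈L) _     = none ∘ lose q∈L
    np′ (there p∈L) (here refl) _     = none ∘ lose p∈L ∘ ≈-trans (≈-reflexive (+-comm (δ x) _))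
    np′ (there p∈L) (there q∈L) p≢q   = np p∈L q∈L p≢q

  two-pairs⇒solution : ∀ p q p′ q′ L → δ p + δ q ≈ 0 → δ p′ + δ q′ ≈ 0 →
                       Unique (p ∷ q ∷ p′ ∷ q′ ∷ L) → Solution (p ∷ q ∷ p′ ∷ q′ ∷ L)
  two-pairs⇒solution p q p′ q′ L pq≈0 p′q′≈0 uL =
    [ sublist-solution (refl ∷ refl ∷ minimum _) uL Σpq≈0
    , [ sublist-solution (p ∷ʳ q ∷ʳ refl ∷ refl ∷ minimum _) uL Σp′q′≈0
      , sublist-solution (refl ∷ refl ∷ refl ∷ refl ∷ minimum _) uL Σpqp′q′≈0
        ∘ subst (Admissible 4) (sym (sumBy-++ y (p ∷ q ∷ []) (p′ ∷ q′ ∷ [])))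
      ]′
    ]′ (two-pairs (Σy (p ∷ q ∷ [])) (Σy (p′ ∷ q′ ∷ [])))
    where
    Σpq≈0 : Σδ (p ∷ q ∷ []) ≈ 0
    Σpq≈0 = ≈-trans (≈-reflexive (Σδ-pair p q)) pq≈0
    Σp′q′≈0 : Σδ (p′ ∷ q′ ∷ []) ≈ 0
    Σp′q′≈0 = ≈-trans (≈-reflexive (Σδ-pair p′ q′)) p′q′≈0
    Σpqp′q′≈0 : Σδ (p ∷ q ∷ p′ ∷ q′ ∷ []) ≈ 0
    Σpqp′q′≈0 =
      ≈-trans (≈-reflexive (sumBy-++ δ (p ∷ q ∷ []) (p′ ∷ q′ ∷ []))) (+-cong Σpq≈0 Σp′q′≈0)

  one-pair⇒solution : ∀ p q L → length L ≡ 4 + w → δ p + δ q ≈ 0 →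
                      Unique (p ∷ q ∷ L) → NoZero (p ∷ q ∷ L) → NoZeroPair L → Solution (p ∷ q ∷ L)
  one-pair⇒solution p q (e ∷ L) |e∷L| pq≈0 (_ ∷ _ ∷ ue∷L) nz np
    with solution-or-row e L (≤-reflexive (sym (suc-injective |e∷L|))) ue∷L (nz ∘ there ∘ there) np
  ... | inj₁ sol = Solution-mono (there ∘ there) sol
  one-pair⇒solution p q (e ∷ e′ ∷ Q₁) |L| pq≈0 u nz np | inj₂ row =
    Solution-mono (∈-resp-↭ (↭-sym τ))
      (row-and-pair⇒solution e e′ p q Q₁ (suc-injective (suc-injective |L|)) row (Unique-resp-↭ τ u)
        (nz ∘ ∈-resp-↭ (↭-sym τ)) (NoZeroPair-mono (⊑⇒⊆ (refl ∷ e′ ∷ʳ ⊆-refl)) np) pq≈0)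
    where
    τ : p ∷ q ∷ e ∷ e′ ∷ Q₁ ↭ e ∷ e′ ∷ p ∷ q ∷ Q₁
    τ = shifts (p ∷ q ∷ []) (e ∷ e′ ∷ [])

  solution-exists : ∀ O → length O ≡ 6 + w → Unique O → NoZero O → Solution O
  solution-exists O |O| uO nz with pair-or-noZeroPair O
  solution-exists (e ∷ L) |O| uO nz | inj₂ np
    with solution-or-row e L (≤-trans (≤-trans (n≤1+n _) (n≤1+n _)) (≤-reflexive (sym (suc-injective |O|))))
                         uO nz np
  ... | inj₁ sol = sol
  ... | inj₂ row =
    ⊥-elim (<⇒≱ (n≤1+n (5 + w)) (subst (_≤ 4 + w) |O| (row-length≤ uO (≈-refl ∷ row))))
  solution-exists O |O| uO nz | inj₁ (p , q , O′ , O↭ , pq≈0) with pair-or-noZeroPair O′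
  ... | inj₁ (p′ , q′ , O″ , O′↭ , p′q′≈0) =
    Solution-mono (∈-resp-↭ (↭-sym σ))
      (two-pairs⇒solution p q p′ q′ O″ pq≈0 p′q′≈0 (Unique-resp-↭ σ uO))
    where
    σ : O ↭ p ∷ q ∷ p′ ∷ q′ ∷ O″
    σ = ↭-trans O↭ (prep p (prep q O′↭))
  ... | inj₂ np′ =
    Solution-mono (∈-resp-↭ (↭-sym O↭))
      (one-pair⇒solution p q O′ |O′| pq≈0 (Unique-resp-↭ O↭ uO) (nz ∘ ∈-resp-↭ (↭-sym O↭)) np′)
    where
    |O′| : length O′ ≡ 4 + w
    |O′| = suc-injective (suc-injective (trans (sym (↭-length O↭)) |O|))

x-coord y-coord : ∀ {m} → ZZ m → ℕ
x-coord = toℕ ∘ proj₁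
y-coord = toℕ ∘ proj₂

module RowCompletion (w : ℕ) (a y₀ : Fin (4 + w)) where

  open Congruence (4 + w)

  rowPoint : ℕ → ZZ (4 + w)
  rowPoint o = a , residue (toℕ y₀ + o)

  rowPoints : List (ZZ (4 + w))
  rowPoints = map rowPoint (range 1 (3 + w))

  Completable : ℕ → ℕ → Set
  Completable j t = ∃ λ R → R ⊑ rowPoints × length R + j ≡ 4 + w × sumBy y-coord R + t ≈ 0

  base : ℕ → ℕ
  base k = k * toℕ y₀ + sum (range 1 k)

  rowPoints-y-sum : ∀ os → sumBy y-coord (map rowPoint os) ≈ length os * toℕ y₀ + sum os
  rowPoints-y-sum []       = ≈-refl
  rowPoints-y-sum (o ∷ os) = ≈-trans (+-cong (toℕ-residue (toℕ y₀ + o)) (rowPoints-y-sum os))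
                                     (≈-reflexive (+-interchange (toℕ y₀) o _ (sum os)))

  completable : ∀ k e t → k + e ≡ 3 + w → negate (t + base k) ≤ k * e → Completable (suc e) t
  completable k e t k+e q≤ with os , os⊑ , |os| , Σos ← subset-sums 1 k e (negate (t + base k)) q≤ =
    map rowPoint os , ⊑-map⁺ rowPoint (subst (λ l → os ⊑ range 1 l) k+e os⊑) , |R|+j , R+t≈0
    where
    q = negate (t + base k)
    |R|+j : length (map rowPoint os) + suc e ≡ 4 + w
    |R|+j = trans (cong (_+ suc e) (trans (length-map rowPoint os) |os|)) (trans (+-suc k e) (cong suc k+e))
    regroup : ∀ k y σ q t → k * y + (σ + q) + t ≡ t + (k * y + σ) + q
    regroup = solve-∀
    R+t≈0 : sumBy y-coord (map rowPoint os) + t ≈ 0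
    R+t≈0 = begin
      sumBy y-coord (map rowPoint os) + t      ≈⟨ +-congʳ t (rowPoints-y-sum os) ⟩
      length os * toℕ y₀ + sum os + t          ≡⟨ cong₂ (λ l σ → l * toℕ y₀ + σ + t) |os| Σos ⟩
      k * toℕ y₀ + (sum (range 1 k) + q) + t   ≡⟨ regroup k (toℕ y₀) (sum (range 1 k)) q t ⟩
      t + base k + q                           ≈⟨ +-negate (t + base k) ⟩
      0                                        ∎
      where open ≈-Reasoning

  completable-unless-top : ∀ k e t → k + e ≡ 3 + w → k * e ≡ 2 + w →
                           Completable (suc e) t ⊎ negate (t + base k) ≡ 3 + w
  completable-unless-top k e t k+e k*e with m≤n⇒m<n∨m≡n (≤-pred (negate<m (t + base k)))
  ... | inj₁ q<3+w = inj₁ (completable k e t k+e (≤-trans (≤-pred q<3+w) (≤-reflexive (sym k*e))))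
  ... | inj₂ q≡3+w = inj₂ q≡3+w

  dichotomy : ∀ k e → k + e ≡ 3 + w → k * e ≡ 2 + w → Dichotomous w Completable (suc e)
  dichotomy k e k+e k*e {t} {t′} t≉t′
    with completable-unless-top k e t k+e k*e | completable-unless-top k e t′ k+e k*e
  ... | inj₁ c   | _         = inj₁ c
  ... | inj₂ _   | inj₁ c′   = inj₂ c′
  ... | inj₂ top | inj₂ top′ =
    ⊥-elim (t≉t′ (+-cancelʳ-≈ (base k) (negate-injective (trans top (sym top′)))))

  middle : ∀ {j t} → 3 ≤ j → j ≤ 2 + w → Completable j t
  middle {suc e} {t} (s≤s 2≤e) (s≤s e≤1+w) = completable k e t k+e
    (≤-trans (≤-pred (negate<m (t + base k))) (≤-trans (≤-reflexive (sym k+e)) (k+e≤k*e 2≤k 2≤e)))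
    where
    k = 3 + w ∸ e
    k+e : k + e ≡ 3 + w
    k+e = m∸n+n≡m (≤-trans e≤1+w (≤-trans (n≤1+n _) (n≤1+n _)))
    2≤k : 2 ≤ k
    2≤k = subst (_≤ k) (m+n∸n≡m 2 (1 + w)) (∸-monoʳ-≤ (3 + w) e≤1+w)

  -- For m = 4, if both pairs have the excluded y-sum 1 − base 2, together they have the y-sum
  -- 2 − 2 · base 2 ≡ 0 (mod 4).
  two-pairs : w ≡ 0 ⊎ 2 ≤ w → ∀ t t′ → Completable 2 t ⊎ Completable 2 t′ ⊎ Completable 4 (t + t′)
  two-pairs (inj₂ 2≤w) t t′ = inj₂ (inj₂ (middle (s≤s (s≤s (s≤s z≤n))) (s≤s (s≤s 2≤w))))
  two-pairs (inj₁ refl) t t′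
    with completable-unless-top 2 1 t refl refl | completable-unless-top 2 1 t′ refl refl
  ... | inj₁ c   | _         = inj₁ c
  ... | inj₂ _   | inj₁ c′   = inj₂ (inj₁ c′)
  ... | inj₂ top | inj₂ top′ =
    inj₂ (inj₂ (completable 0 3 (t + t′) refl (≤-reflexive (negate-≈0 t+t′≈0))))
    where
    y = toℕ y₀
    +3≈0 : ∀ {t} → negate (t + base 2) ≡ 3 → t + base 2 + 3 ≈ 0
    +3≈0 {t} top = subst (λ q → t + base 2 + q ≈ 0) top (+-negate (t + base 2))
    regroup : ∀ t t′ y → t + t′ + 0 + 4 * (y + 3) ≡ (t + (2 * y + 3) + 3) + (t′ + (2 * y + 3) + 3)
    regroup = solve-∀
    t+t′≈0 : t + t′ + base 0 ≈ 0
    t+t′≈0 = begin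
      t + t′ + 0                             ≡⟨ +-identityʳ _ ⟨
      t + t′ + 0 + 0                         ≈⟨ +-congˡ (t + t′ + 0) (m*≈0 (y + 3)) ⟨
      t + t′ + 0 + 4 * (y + 3)               ≡⟨ regroup t t′ y ⟩
      (t + base 2 + 3) + (t′ + base 2 + 3)   ≈⟨ +-cong (+3≈0 {t} top) (+3≈0 {t′} top′) ⟩
      0                                      ∎
      where open ≈-Reasoning

  admissibility : w ≡ 0 ⊎ 2 ≤ w → Admissibility w
  admissibility parity = record
    { Admissible          = Completable
    ; middle              = middle
    ; pair-dichotomy      = dichotomy (2 + w) 1 (+-comm (2 + w) 1) (*-identityʳ (2 + w))
    ; near-full-dichotomy = dichotomy 1 (2 + w) refl (+-identityʳ (2 + w))
    ; two-pairs           = two-pairs parity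
    }

  rowPoint-injective : ∀ {o o′} → o < 4 + w → o′ < 4 + w → rowPoint o ≡ rowPoint o′ → o ≡ o′
  rowPoint-injective o< o′< eq =
    ≈⇒≡ o< o′< (+-cancelˡ-≈ (toℕ y₀) (residue-injective (cong proj₂ eq)))

  rowPoints-unique : Unique rowPoints
  rowPoints-unique = unique-from 1 (3 + w) ≤-refl
    where
    unique-from : ∀ s l → s + l ≤ 4 + w → Unique (map rowPoint (range s l))
    unique-from s zero    _    = []
    unique-from s (suc l) s+l≤ = All-map⁺ (All.tabulate distinct) ∷ unique-from (suc s) l s+l≤′
      where
      s+l≤′ : suc (s + l) ≤ 4 + w
      s+l≤′ = ≤-trans (≤-reflexive (sym (+-suc s l))) s+l≤
      distinct : ∀ {o} → o ∈ range (suc s) l → rowPoint s ≢ rowPoint o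
      distinct o∈ eq with s<o , o< ← ∈-range⁻ (suc s) l o∈ =
        <-irrefl (rowPoint-injective (≤-trans (s≤s (m≤m+n s l)) s+l≤′) (≤-trans o< s+l≤′) eq) s<o

  rowPoint≢y₀ : ∀ {o} → o ∈ range 1 (3 + w) → proj₂ (rowPoint o) ≢ y₀
  rowPoint≢y₀ o∈ eq with 1≤o , o< ← ∈-range⁻ 1 (3 + w) o∈ =
    <⇒≢ 1≤o (sym (≈⇒≡ o< (s≤s z≤n) (+-cancelˡ-≈ (toℕ y₀) y₀+o≈y₀+0)))
    where
    y₀+o≈y₀+0 : toℕ y₀ + _ ≈ toℕ y₀ + 0
    y₀+o≈y₀+0 =
      ≈-trans (≈-sym (toℕ-residue _)) (≈-reflexive (trans (cong toℕ eq) (sym (+-identityʳ _))))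

module ZeroSum (w : ℕ) (X : List (ZZ (4 + w))) (X-unique : Unique X) (a : Fin (4 + w)) where

  open Congruence (4 + w)
  open import Data.List.Membership.DecPropositional {A = ZZ (4 + w)} (≡-dec _≟ᶠ_ _≟ᶠ_) using (_∈?_)

  in-row? : Decidable (λ (p : ZZ (4 + w)) → proj₁ p ≡ a)
  in-row? p = proj₁ p ≟ᶠ a

  Row OffRow : List (ZZ (4 + w))
  Row    = filter in-row? X
  OffRow = filter (∁? in-row?) X

  absent⇒∉Row : ∀ {y} → (a , y) ∉ X → All ((a , y) ≢_) Row
  absent⇒∉Row y∉X =
    All.tabulate λ p∈Row eq → y∉X (subst (_∈ X) (sym eq) (proj₁ (∈-filter⁻ in-row? {xs = X} p∈Row)))

  missing-at-most-one : length Row ≡ 3 + w → ∃ λ y₀ → ∀ y → y ≢ y₀ → (a , y) ∈ X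
  missing-at-most-one |Row| with all-Fin? (λ y → (a , y) ∈? X)
  ... | yes all-present = zero , λ y _ → all-present y
  ... | no ¬all-present with y₀ , y₀∉X ← ¬∀⟶∃¬ (4 + w) _ (λ y → (a , y) ∈? X) ¬all-present =
    y₀ , present
    where
    present : ∀ y → y ≢ y₀ → (a , y) ∈ X
    present y y≢y₀ with (a , y) ∈? X
    ... | yes y∈X = y∈X
    ... | no y∉X = ⊥-elim (<-irrefl refl (begin-strict
      4 + w                                  <⟨ n<1+n (4 + w) ⟩
      2 + (3 + w)                            ≡⟨ cong (2 +_) |Row| ⟨
      length ((a , y₀) ∷ (a , y) ∷ Row)     ≤⟨ Unique-⊆⇒length≤ unique row⊆ ⟩
      length (map (a ,_) (allFin (4 + w)))  ≡⟨ trans (length-map _ (allFin (4 + w))) (length-tabulate id) ⟩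
      4 + w                                  ∎))
      where
      open ≤-Reasoning
      unique : Unique ((a , y₀) ∷ (a , y) ∷ Row)
      unique =
        (y≢y₀ ∘ sym ∘ cong proj₂ ∷ absent⇒∉Row y₀∉X) ∷ absent⇒∉Row y∉X ∷ filter⁺ in-row? X-unique
      row⊆ : (a , y₀) ∷ (a , y) ∷ Row ⊆ map (a ,_) (allFin (4 + w))
      row⊆ (here refl)           = ∈-map⁺ (a ,_) (∈-allFin y₀)
      row⊆ (there (here refl))   = ∈-map⁺ (a ,_) (∈-allFin y)
      row⊆ (there (there p∈Row)) with refl ← proj₂ (∈-filter⁻ in-row? {xs = X} p∈Row) =
        ∈-map⁺ (a ,_) (∈-allFin _)

  D : ℕ
  D = 4 + w ∸ toℕ a

  D+a≡m : D + toℕ a ≡ 4 + w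
  D+a≡m = m∸n+n≡m (<⇒≤ (toℕ<n a))

  -- δ p ≡ x-coord p − a (mod 4 + w), written without truncated subtraction.
  δ : ZZ (4 + w) → ℕ
  δ p = x-coord p + D

  δ≈0⇒in-row : ∀ {p} → δ p ≈ 0 → proj₁ p ≡ a
  δ≈0⇒in-row δp≈0 = toℕ-≈-injective (+-cancelʳ-≈ D (≈-trans δp≈0 (≈-sym a+D≈0)))
    where
    a+D≈0 : toℕ a + D ≈ 0
    a+D≈0 = ≈-trans (≈-reflexive (trans (+-comm (toℕ a) D) D+a≡m)) m≈0

  point-injective : ∀ {p q} → δ p ≈ δ q → y-coord p ≈ y-coord q → p ≡ q
  point-injective {_ , _} {_ , _} δ≈ y≈ =
    cong₂ _,_ (toℕ-≈-injective (+-cancelʳ-≈ D δ≈)) (toℕ-≈-injective y≈)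

  OffRow-nonzero : ∀ {p} → p ∈ OffRow → δ p ≉ 0
  OffRow-nonzero {p} p∈ = proj₂ (∈-filter⁻ (∁? in-row?) {xs = X} p∈) ∘ δ≈0⇒in-row {p}

  |OffRow| : length X ≡ (4 + w) + (4 + w) + 1 → length Row ≡ 3 + w → length OffRow ≡ 6 + w
  |OffRow| |X| |Row| = +-cancelˡ-≡ (3 + w) _ _ (begin
    3 + w + length OffRow        ≡⟨ cong (_+ length OffRow) |Row| ⟨
    length Row + length OffRow   ≡⟨ length-partition-filter in-row? X ⟨
    length X                     ≡⟨ |X| ⟩
    (4 + w) + (4 + w) + 1        ≡⟨ regroup w ⟩
    3 + w + (6 + w)              ∎)
    where
    open ≡-Reasoning
    regroup : ∀ w → (4 + w) + (4 + w) + 1 ≡ 3 + w + (6 + w)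
    regroup = solve-∀

  x-sum≈0 : ∀ {R T} → All (λ p → proj₁ p ≡ a) R → length R + length T ≡ 4 + w →
            sumBy δ T ≈ 0 → sumBy x-coord (R ++ T) ≈ 0
  x-sum≈0 {R} {T} R-in-row |R|+|T| T≈0 = begin
    sumBy x-coord (R ++ T)      ≡⟨ sumBy-++ x-coord R T ⟩
    sumBy x-coord R + σ         ≡⟨ cong (_+ σ) (sumBy-const x-coord (All.map (cong toℕ) R-in-row)) ⟩
    k * A + σ                   ≡⟨ +-identityʳ _ ⟨
    k * A + σ + 0               ≈⟨ +-congˡ (k * A + σ) (*m≈0 j) ⟨
    k * A + σ + j * (4 + w)     ≡⟨ cong (λ n → k * A + σ + j * n) D+a≡m ⟨
    k * A + σ + j * (D + A)     ≡⟨ regroup k A σ j D ⟩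
    (k + j) * A + (σ + j * D)   ≡⟨ cong₂ (λ n s → n * A + s) |R|+|T| (sym (sumBy-+-const x-coord D T)) ⟩
    (4 + w) * A + sumBy δ T     ≈⟨ +-cong (m*≈0 A) T≈0 ⟩
    0                           ∎
    where
    open ≈-Reasoning
    A = toℕ a
    k = length R
    j = length T
    σ = sumBy x-coord T
    regroup : ∀ k A σ j D → k * A + σ + j * (D + A) ≡ (k + j) * A + (σ + j * D)
    regroup = solve-∀

  module _ (parity : w ≡ 0 ⊎ 2 ≤ w) (y₀ : Fin (4 + w)) (present : ∀ y → y ≢ y₀ → (a , y) ∈ X) where

    open RowCompletion w a y₀
    open Selection w δ y-coord point-injective (admissibility parity)

    rowPoints⊆X : rowPoints ⊆ X
    rowPoints⊆X v∈ with o , o∈ , refl ← ∈-map⁻ rowPoint v∈ = present _ (rowPoint≢y₀ o∈)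

    rowPoints-in-row : All (λ p → proj₁ p ≡ a) rowPoints
    rowPoints-in-row = All.tabulate λ v∈ → case ∈-map⁻ rowPoint v∈ of λ where (_ , _ , refl) → refl

    solution⇒zero-sum-subset : Solution OffRow →
                               ∃ λ S → Unique S × S ⊆ X × length S ≡ 4 + w × SumsToZero (4 + w) S
    solution⇒zero-sum-subset (solution T T⊆OffRow T-unique T≈0 (R , R⊑ , |R|+|T| , R+T≈0)) =
      R ++ T , Unique-++⁺ (Unique-resp-⊒ R⊑ rowPoints-unique) T-unique disjoint , S⊆X ,
      trans (length-++ R) |R|+|T| ,
      ≈0⇒%≡0 (x-sum≈0 R-in-row |R|+|T| T≈0) ,
      ≈0⇒%≡0 (≈-trans (≈-reflexive (sumBy-++ y-coord R T)) R+T≈0)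
      where
      R-in-row : All (λ p → proj₁ p ≡ a) R
      R-in-row = All-resp-⊆ R⊑ rowPoints-in-row
      off-row : ∀ {v} → v ∈ T → proj₁ v ≢ a
      off-row v∈T = proj₂ (∈-filter⁻ (∁? in-row?) {xs = X} (T⊆OffRow v∈T))
      disjoint : ∀ {v} → v ∈ R × v ∈ T → ⊥
      disjoint (v∈R , v∈T) = off-row v∈T (All.lookup R-in-row v∈R)
      S⊆X : R ++ T ⊆ X
      S⊆X v∈ with ∈-++⁻ R v∈
      ... | inj₁ v∈R = rowPoints⊆X (⊑⇒⊆ R⊑ v∈R)
      ... | inj₂ v∈T = proj₁ (∈-filter⁻ (∁? in-row?) {xs = X} (T⊆OffRow v∈T))

    zero-sum-subset-with-gap : length X ≡ (4 + w) + (4 + w) + 1 → length Row ≡ 3 + w →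
                              ∃ λ S → Unique S × S ⊆ X × length S ≡ 4 + w × SumsToZero (4 + w) S
    zero-sum-subset-with-gap |X| |Row| = solution⇒zero-sum-subset
      (solution-exists OffRow (|OffRow| |X| |Row|) (filter⁺ (∁? in-row?) X-unique) OffRow-nonzero)

  zero-sum-subset : w ≡ 0 ⊎ 2 ≤ w → length X ≡ (4 + w) + (4 + w) + 1 → length Row ≡ 3 + w →
                    ∃ λ S → Unique S × S ⊆ X × length S ≡ 4 + w × SumsToZero (4 + w) S
  zero-sum-subset parity |X| |Row| with y₀ , present ← missing-at-most-one |Row| =
    zero-sum-subset-with-gap parity y₀ present |X| |Row|

zero-sum-at : ∀ m w → m ≡ 4 + w → .{{_ : NonZero m}} → w ≡ 0 ⊎ 2 ≤ w →
              (X : List (ZZ m)) → Unique X → length X ≡ m + m + 1 →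
              (∃ λ a → rowCount a X ≡ m ∸ 1) →
              ∃ λ S → Unique S × S ⊆ X × length S ≡ m × SumsToZero m S
zero-sum-at .(4 + w) w refl parity X X-unique |X| (a , |Row|) =
  ZeroSum.zero-sum-subset w X X-unique a parity |X| |Row|

theorem3p7 : (k : ℕ) → let n = suc k in
    (X : List (ZZ (2 * n))) → Unique X → length X ≡ 4 * n + 1 →
    (∃ λ (a : Fin (2 * n)) → rowCount a X ≡ 2 * n ∸ 1) →
    ∃ λ (S : List (ZZ (2 * n))) → Unique S × S ⊆ X × length S ≡ 2 * n × SumsToZero (2 * n) S
theorem3p7 zero X X-unique |X| _ =
  ⊥-elim (<-irrefl refl (≤-trans (≤-reflexive (sym |X|)) (Unique-⊆⇒length≤ X-unique all-points)))
  where
  all-points : X ⊆ cartesianProduct (allFin 2) (allFin 2)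
  all-points {x , y} _ = ∈-cartesianProduct⁺ (∈-allFin x) (∈-allFin y)
theorem3p7 (suc k) X X-unique |X| row =
  zero-sum-at (2 * (2 + k)) (k + k) (m≡4+w k) (parity k) X X-unique (trans |X| (|X|≡m+m+1 k)) row
  where
  m≡4+w : ∀ k → 2 * (2 + k) ≡ 4 + (k + k)
  m≡4+w = solve-∀
  |X|≡m+m+1 : ∀ k → 4 * (2 + k) + 1 ≡ 2 * (2 + k) + 2 * (2 + k) + 1
  |X|≡m+m+1 = solve-∀
  parity : ∀ k → k + k ≡ 0 ⊎ 2 ≤ k + k
  parity zero    = inj₁ refl
  parity (suc k) = inj₂ (s≤s (≤-trans (s≤s z≤n) (≤-reflexive (sym (+-suc k k)))))
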